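{- $\vdash_{e\mathcal{I}_s} \forall x, y : \mathrm{Prop} .\, (x =_\mathrm{Prop} y) \supset (x = y)$
   Context: $\mathcal{I}_s$ is an illative system of classical higher-order logic with subtyping and basic inductive types, built on the untyped $\lambda$-calculus, with primitive constants $\mathrm{Type}, \mathrm{Prop}, \mathrm{Is}, \mathrm{Subtype}, \mathrm{Fun}, \forall, \vee, \bot, \epsilon, \mathrm{Eq}, \mathrm{Cond}$; $t:\alpha\equiv\mathrm{Is}\,t\,\alpha$, $\alpha\to\beta\equiv\mathrm{Fun}\,\alpha\,\beta$, $\forall x:\alpha.\varphi\equiv\forall\,\alpha\,(\lambda x.\varphi)$, $\varphi\supset\psi\equiv\forall x:(\mathrm{Subtype}\,\mathrm{Prop}\,(\lambda y.\varphi)).\psi$ ($x,y$ fresh), $t_1=t_2$ denotes $\mathrm{Eq}\,t_1\,t_2$ (a meta-level-like equality with $\beta$-axiom, congruence rules, and rewriting of derived formulas). It has natural-deduction rules for the connectives and quantifiers (implication introduction requires $\varphi:\mathrm{Prop}$; $\forall$-introduction requires $\alpha:\mathrm{Type}$), typing rules, and excluded middle only as $\forall p:\mathrm{Prop}.p\vee\neg p$. Leibniz equality: $t_1=_\alpha t_2\equiv\forall p:\alpha\to\mathrm{Prop}.\,p\,t_1\supset p\,t_2$. The extensional variant $e\mathcal{I}_s$ adds the rule: from $\Gamma\vdash\varphi_1\supset\varphi_2$ and $\Gamma\vdash\varphi_2\supset\varphi_1$ infer $\Gamma\vdash\varphi_1=\varphi_2$, and the functional extensionality rule: from $\alpha:\mathrm{Type}$,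 $\beta:\mathrm{Type}$ infer $\forall f_1,f_2:\alpha\to\beta.(\forall x:\alpha.f_1x=_\beta f_2x)\supset(f_1=_{\alpha\to\beta}f_2)$. -}

module Defs where

-- Deep embedding of (a fragment of) the illative system eI_s.
-- Terms: untyped λ-terms with de Bruijn indices over the primitive constants.

open import Data.Nat using (ℕ; zero; suc; _<ᵇ_)
open import Data.Bool using (if_then_else_)
open import Data.List using (List; _∷_; []; map)
open import Data.List.Membership.Propositional using (_∈_)
open import Relation.Binary.Construct.Closure.Equivalence using (EqClosure)

data Const : Set where
  Type Prop Is Subtype Fun All Or Bot Eps Eq Cond : Const

data Tm : Set where
  var : ℕ → Tm
  con : Const → Tm
  app : Tm → Tm → Tm
  lam : Tm → Tm

shiftFrom : ℕ → Tm → Tm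
shiftFrom c (var n)   = if n <ᵇ c then var n else var (suc n)
shiftFrom c (con k)   = con k
shiftFrom c (app t s) = app (shiftFrom c t) (shiftFrom c s)
shiftFrom c (lam t)   = lam (shiftFrom (suc c) t)

infix 30 ↑_
infix 15 _∶_
infixr 20 _⇒_
infixr 12 _⊃_
infix 14 _≐_

↑_ : Tm → Tm
↑ t = shiftFrom 0 t

substAt : ℕ → Tm → Tm → Tm
substAt c s (var n) with n <ᵇ c
... | Data.Bool.true  = var n
... | Data.Bool.false with c <ᵇ n
...   | Data.Bool.true  = var (Data.Nat.pred n)
...   | Data.Bool.false = s
substAt c s (con k)   = con k
substAt c s (app t u) = app (substAt c s t) (substAt c s u)
substAt c s (lam t)   = lam (substAt (suc c) (↑ s) t)

data _⟶β_ : Tm → Tm → Set where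
  beta : ∀ {t s} → app (lam t) s ⟶β substAt 0 s t
  appˡ : ∀ {t t' s} → t ⟶β t' → app t s ⟶β app t' s
  appʳ : ∀ {t s s'} → s ⟶β s' → app t s ⟶β app t s'
  ξ    : ∀ {t t'} → t ⟶β t' → lam t ⟶β lam t'

_=β_ : Tm → Tm → Set
_=β_ = EqClosure _⟶β_

_∶_ : Tm → Tm → Tm
t ∶ α = app (app (con Is) t) α

_⇒_ : Tm → Tm → Tm
α ⇒ β = app (app (con Fun) α) β

`Type `Prop `⊥ : Tm
`Type = con Type
`Prop = con Prop
`⊥ = con Bot

-- ∀ x : α . φ  ≡  ∀ α (λx.φ)   (φ lives in the scope extended by x = var 0)
Π : Tm → Tm → Tm
Π α φ = app (app (con All) α) (lam φ)

-- φ ⊃ ψ  ≡  ∀ x : (Subtype Prop (λy.φ)). ψ   (x, y fresh)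
_⊃_ : Tm → Tm → Tm
φ ⊃ ψ = app (app (con All) (app (app (con Subtype) `Prop) (lam (↑ φ)))) (lam (↑ ψ))

_≐_ : Tm → Tm → Tm
t₁ ≐ t₂ = app (app (con Eq) t₁) t₂

Leibniz : Tm → Tm → Tm → Tm
Leibniz α t₁ t₂ = Π (α ⇒ `Prop) (app (var 0) (↑ t₁) ⊃ app (var 0) (↑ t₂))

Ctx : Set
Ctx = List Tm

_,∶_ : Ctx → Tm → Ctx
Γ ,∶ α = (var 0 ∶ ↑ α) ∷ map ↑_ Γ

infix 3 _⊢_

data _⊢_ (Γ : Ctx) : Tm → Set where
  ax      : ∀ {φ} → φ ∈ Γ → Γ ⊢ φ
  eq-β    : ∀ {t t'} → t =β t' → Γ ⊢ t ≐ t'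
  eq-sym  : ∀ {t t'} → Γ ⊢ t ≐ t' → Γ ⊢ t' ≐ t
  eq-trans : ∀ {t t' t''} → Γ ⊢ t ≐ t' → Γ ⊢ t' ≐ t'' → Γ ⊢ t ≐ t''
  eq-app  : ∀ {t t' s s'} → Γ ⊢ t ≐ t' → Γ ⊢ s ≐ s' → Γ ⊢ app t s ≐ app t' s'
  eq-rw   : ∀ {φ ψ} → Γ ⊢ φ → Γ ⊢ φ ≐ ψ → Γ ⊢ ψ
  ∀I      : ∀ {α β} → (Γ ,∶ α) ⊢ app (↑ β) (var 0) → Γ ⊢ α ∶ `Type
          → Γ ⊢ app (app (con All) α) β
  ∀E      : ∀ {α β t} → Γ ⊢ app (app (con All) α) β → Γ ⊢ t ∶ α → Γ ⊢ app β t
  ⊃I      : ∀ {φ ψ} → (φ ∷ Γ) ⊢ ψ → Γ ⊢ φ ∶ `Prop → Γ ⊢ φ ⊃ ψ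
  ⊃E      : ∀ {φ ψ} → Γ ⊢ φ ⊃ ψ → Γ ⊢ φ → Γ ⊢ ψ
  prop-type : Γ ⊢ `Prop ∶ `Type
  fun-type  : ∀ {α β} → Γ ⊢ α ∶ `Type → Γ ⊢ β ∶ `Type → Γ ⊢ (α ⇒ β) ∶ `Type
  funI    : ∀ {α β t} → (Γ ,∶ α) ⊢ app (↑ t) (var 0) ∶ ↑ β → Γ ⊢ α ∶ `Type
          → Γ ⊢ t ∶ (α ⇒ β)
  funE    : ∀ {α β t s} → Γ ⊢ t ∶ (α ⇒ β) → Γ ⊢ s ∶ α → Γ ⊢ app t s ∶ β
  ∀-prop  : ∀ {α β} → (Γ ,∶ α) ⊢ app (↑ β) (var 0) ∶ `Prop → Γ ⊢ α ∶ `Type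
          → Γ ⊢ app (app (con All) α) β ∶ `Prop
  ⊃-prop  : ∀ {φ ψ} → Γ ⊢ φ ∶ `Prop → Γ ⊢ ψ ∶ `Prop → Γ ⊢ (φ ⊃ ψ) ∶ `Prop
  prop-ext : ∀ {φ₁ φ₂} → Γ ⊢ φ₁ ⊃ φ₂ → Γ ⊢ φ₂ ⊃ φ₁ → Γ ⊢ φ₁ ≐ φ₂
  fun-ext  : ∀ {α β} → Γ ⊢ α ∶ `Type → Γ ⊢ β ∶ `Type
           → Γ ⊢ Π (α ⇒ β) (Π (↑ (α ⇒ β))
                 (Π (↑ ↑ α)
                    (Leibniz (↑ ↑ ↑ β) (app (var 2) (var 0)) (app (var 1) (var 0)))
                  ⊃ Leibniz (↑ ↑ (α ⇒ β)) (var 1) (var 0)))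

module Submission where

-- Leibniz equality x =_Prop y transports every predicate p : Prop → Prop
-- from x to y.  Choosing the motives  λz. x ⊃ z  and  λz. z ⊃ x  and starting
-- from the trivial  x ⊃ x  yields  x ⊃ y  and  y ⊃ x;  propositional
-- extensionality then gives  x = y.

open import Defs
open import Data.Nat using (suc; _<ᵇ_; _<_; _≤_; z≤n; s≤s; s<s; _<?_)
open import Data.Nat.Properties
  using (<⇒<ᵇ; <ᵇ⇒<; ≤⇒≯; <⇒≱; <-irrefl; <-cmp; <-≤-trans; ≤-trans; n≤1+n; n<1+n;
         m≤n⇒m≤1+n; m<n⇒m<1+n; <⇒≤; ≮⇒≥)
open import Data.Bool using (true; false)
open import Data.Empty using (⊥-elim)
open import Data.List using ([])
open import Data.List.Membership.Propositional using (_∈_)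
open import Data.List.Membership.Propositional.Properties using (∈-map⁺)
open import Data.List.Relation.Unary.Any using (here; there)
open import Relation.Nullary using (yes; no)
open import Relation.Binary using (tri<; tri≈; tri>)
open import Relation.Binary.PropositionalEquality
  using (_≡_; refl; sym; trans; cong; cong₂; subst; module ≡-Reasoning)
open import Relation.Binary.Construct.Closure.Symmetric using (fwd; bwd)
open import Relation.Binary.Construct.Closure.ReflexiveTransitive using (ε; _◅_)

shift-var-< : ∀ {c n} → n < c → shiftFrom c (var n) ≡ var n
shift-var-< {c} {n} n<c with n <ᵇ c | <⇒<ᵇ n<c
... | true | _ = refl

shift-var-≥ : ∀ {c n} → c ≤ n → shiftFrom c (var n) ≡ var (suc n)
shift-var-≥ {c} {n} c≤n with n <ᵇ c | <ᵇ⇒< n c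
... | true  | n<c = ⊥-elim (≤⇒≯ c≤n (n<c _))
... | false | _   = refl

subst-var-< : ∀ {c n s} → n < c → substAt c s (var n) ≡ var n
subst-var-< {c} {n} n<c with n <ᵇ c | <⇒<ᵇ n<c
... | true | _ = refl

subst-var-≡ : ∀ {c s} → substAt c s (var c) ≡ s
subst-var-≡ {c} with c <ᵇ c | <ᵇ⇒< c c
... | true  | c<c = ⊥-elim (<-irrefl refl (c<c _))
... | false | _ with c <ᵇ c | <ᵇ⇒< c c
...   | true  | c<c = ⊥-elim (<-irrefl refl (c<c _))
...   | false | _   = refl

subst-var-> : ∀ {c m s} → c ≤ m → substAt c s (var (suc m)) ≡ var m
subst-var-> {c} {m} c≤m with suc m <ᵇ c | <ᵇ⇒< (suc m) c
... | true  | m<c = ⊥-elim (<⇒≱ (m<c _) (≤-trans c≤m (n≤1+n m)))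
... | false | _ with c <ᵇ suc m | <⇒<ᵇ (s≤s c≤m)
...   | true | _ = refl

shift-shift : ∀ {e d} → e ≤ d → ∀ t →
  shiftFrom (suc d) (shiftFrom e t) ≡ shiftFrom e (shiftFrom d t)
shift-shift {e} {d} e≤d (var n) with n <? e | n <? d
... | yes n<e | _ rewrite shift-var-< n<e | shift-var-< (<-≤-trans n<e e≤d)
                        | shift-var-< (<-≤-trans n<e (m≤n⇒m≤1+n e≤d)) | shift-var-< n<e = refl
... | no n≮e | yes n<d rewrite shift-var-≥ (≮⇒≥ n≮e) | shift-var-< (s<s n<d)
                             | shift-var-< n<d | shift-var-≥ (≮⇒≥ n≮e) = refl
... | no n≮e | no n≮d rewrite shift-var-≥ (≮⇒≥ n≮e) | shift-var-≥ (s≤s (≮⇒≥ n≮d))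
                            | shift-var-≥ (≮⇒≥ n≮d) | shift-var-≥ (m≤n⇒m≤1+n (≮⇒≥ n≮e)) = refl
shift-shift e≤d (con k)   = refl
shift-shift e≤d (app t s) = cong₂ app (shift-shift e≤d t) (shift-shift e≤d s)
shift-shift e≤d (lam t)   = cong lam (shift-shift (s≤s e≤d) t)

-- Substituting for variable c in a term that was shifted past c does nothing:
-- such a term does not mention c.
subst-shift : ∀ c s t → substAt c s (shiftFrom c t) ≡ t
subst-shift c s (var n) with n <? c
... | yes n<c rewrite shift-var-< n<c = subst-var-< n<c
... | no n≮c rewrite shift-var-≥ (≮⇒≥ n≮c) = subst-var-> (≮⇒≥ n≮c)
subst-shift c s (con k)   = refl
subst-shift c s (app t u) = cong₂ app (subst-shift c s t) (subst-shift c s u)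
subst-shift c s (lam t)   = cong lam (subst-shift (suc c) (↑ s) t)

-- This is the β-contraction  (↑ (λ.φ)) (var 0) → φ  met whenever a
-- rule of the calculus opens a binder  λ.φ  in an extended context.
subst-var-shift : ∀ c t → substAt c (var c) (shiftFrom (suc c) t) ≡ t
subst-var-shift c (var n) with <-cmp n c
... | tri< n<c _ _ rewrite shift-var-< (m<n⇒m<1+n n<c) = subst-var-< n<c
... | tri≈ _ refl _ rewrite shift-var-< (n<1+n c) = subst-var-≡ {c}
... | tri> _ _ c<n rewrite shift-var-≥ c<n = subst-var-> (<⇒≤ c<n)
subst-var-shift c (con k)   = refl
subst-var-shift c (app t u) = cong₂ app (subst-var-shift c t) (subst-var-shift c u)
subst-var-shift c (lam t)   = cong lam (subst-var-shift (suc c) t)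

subst-shift-comm : ∀ {d c} → d ≤ c → ∀ s t →
  substAt (suc c) (shiftFrom d s) (shiftFrom d t) ≡ shiftFrom d (substAt c s t)
subst-shift-comm {d} {c} d≤c s (var n) with <-cmp n c
... | tri≈ _ refl _
  rewrite shift-var-≥ d≤c | subst-var-≡ {suc c} {shiftFrom d s} | subst-var-≡ {c} {s} = refl
... | tri> _ _ (s≤s c≤m)
  rewrite shift-var-≥ (≤-trans d≤c (m≤n⇒m≤1+n c≤m)) | subst-var-> {s = shiftFrom d s} (s≤s c≤m)
        | subst-var-> {s = s} c≤m | shift-var-≥ (≤-trans d≤c c≤m) = refl
... | tri< n<c _ _ with n <? d
...   | yes n<d rewrite shift-var-< n<d | subst-var-< {s = shiftFrom d s} (m<n⇒m<1+n n<c)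
                      | subst-var-< {s = s} n<c | shift-var-< n<d = refl
...   | no n≮d rewrite shift-var-≥ (≮⇒≥ n≮d) | subst-var-< {s = shiftFrom d s} (s<s n<c)
                     | subst-var-< {s = s} n<c | shift-var-≥ (≮⇒≥ n≮d) = refl
subst-shift-comm d≤c s (con k)   = refl
subst-shift-comm d≤c s (app t u) = cong₂ app (subst-shift-comm d≤c s t) (subst-shift-comm d≤c s u)
subst-shift-comm {d} {c} d≤c s (lam t) = cong lam (begin
  substAt (suc (suc c)) (↑ shiftFrom d s) (shiftFrom (suc d) t)
    ≡⟨ cong (λ u → substAt (suc (suc c)) u (shiftFrom (suc d) t)) (sym (shift-shift z≤n s)) ⟩
  substAt (suc (suc c)) (shiftFrom (suc d) (↑ s)) (shiftFrom (suc d) t)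
    ≡⟨ subst-shift-comm (s≤s d≤c) (↑ s) t ⟩
  shiftFrom (suc d) (substAt (suc c) (↑ s) t) ∎)
  where open ≡-Reasoning

subst-⊃ : ∀ s φ ψ → substAt 0 s (φ ⊃ ψ) ≡ (substAt 0 s φ ⊃ substAt 0 s ψ)
subst-⊃ s φ ψ
  rewrite subst-shift-comm {c = 0} z≤n s φ | subst-shift-comm {c = 0} z≤n s ψ = refl

-- The encodings of  Π,  ⊃  and of the typing rules produce
-- β-redexes; the following rules contract or expand them, taking the result
-- of the substitution up to a proven equation.

β-step : ∀ {φ s ψ} → substAt 0 s φ ≡ ψ → app (lam φ) s ⟶β ψ
β-step refl = beta

β-expand : ∀ {Γ φ s ψ} → substAt 0 s φ ≡ ψ → Γ ⊢ ψ → Γ ⊢ app (lam φ) s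
β-expand eq d = eq-rw d (eq-β (bwd (β-step eq) ◅ ε))

β-reduce : ∀ {Γ φ s ψ} → substAt 0 s φ ≡ ψ → Γ ⊢ app (lam φ) s → Γ ⊢ ψ
β-reduce eq d = eq-rw d (eq-β (fwd (β-step eq) ◅ ε))

β-expand-subject : ∀ {Γ φ s ψ α} → substAt 0 s φ ≡ ψ → Γ ⊢ ψ ∶ α → Γ ⊢ app (lam φ) s ∶ α
β-expand-subject eq d = eq-rw d (eq-β (bwd (appˡ (appʳ (β-step eq))) ◅ ε))

weaken-hyp : ∀ {Γ α φ} → φ ∈ Γ → (Γ ,∶ α) ⊢ ↑ φ
weaken-hyp φ∈Γ = ax (there (∈-map⁺ ↑_ φ∈Γ))

-- Introduction, elimination and formation of  Π α φ  with the binder body φ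
-- written directly rather than as  λ.φ  applied to a variable.
Π-intro : ∀ {Γ α φ} → (Γ ,∶ α) ⊢ φ → Γ ⊢ α ∶ `Type → Γ ⊢ Π α φ
Π-intro {φ = φ} d α-type = ∀I (β-expand (subst-var-shift 0 φ) d) α-type

Π-elim : ∀ {Γ α φ t} → Γ ⊢ Π α φ → Γ ⊢ t ∶ α → Γ ⊢ substAt 0 t φ
Π-elim d t-type = β-reduce refl (∀E d t-type)

Π-prop : ∀ {Γ α φ} → (Γ ,∶ α) ⊢ φ ∶ `Prop → Γ ⊢ α ∶ `Type → Γ ⊢ Π α φ ∶ `Prop
Π-prop {φ = φ} d α-type = ∀-prop (β-expand-subject (subst-var-shift 0 φ) d) α-type

lam-type : ∀ {Γ α β t} → (Γ ,∶ α) ⊢ t ∶ ↑ β → Γ ⊢ α ∶ `Type → Γ ⊢ lam t ∶ (α ⇒ β)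
lam-type {t = t} d α-type = funI (β-expand-subject (subst-var-shift 0 t) d) α-type

leibniz-inst : ∀ {Γ α t₁ t₂ p} → Γ ⊢ Leibniz α t₁ t₂ → Γ ⊢ p ∶ (α ⇒ `Prop)
             → Γ ⊢ app p t₁ ⊃ app p t₂
leibniz-inst {Γ} {α} {t₁} {t₂} {p} t₁=t₂ p-type =
  subst (Γ ⊢_) instance-eq (Π-elim t₁=t₂ p-type)
  where
  instance-eq : substAt 0 p (app (var 0) (↑ t₁) ⊃ app (var 0) (↑ t₂)) ≡ (app p t₁ ⊃ app p t₂)
  instance-eq = trans (subst-⊃ p (app (var 0) (↑ t₁)) (app (var 0) (↑ t₂)))
                      (cong₂ (λ u v → app p u ⊃ app p v)
                             (subst-shift 0 p t₁) (subst-shift 0 p t₂))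

leibniz-type : ∀ {Γ α t₁ t₂} → Γ ⊢ α ∶ `Type → (t₁ ∶ α) ∈ Γ → (t₂ ∶ α) ∈ Γ
             → Γ ⊢ Leibniz α t₁ t₂ ∶ `Prop
leibniz-type {α = α} α-type t₁∈Γ t₂∈Γ =
  Π-prop (⊃-prop (funE (ax (here refl)) (weaken-hyp {α = α ⇒ `Prop} t₁∈Γ))
                 (funE (ax (here refl)) (weaken-hyp {α = α ⇒ `Prop} t₂∈Γ)))
         (fun-type α-type prop-type)

-- Transport along Leibniz equality with the motive given as a formula C in
-- one bound variable (the predicate  λ.C).
leibniz-transport : ∀ {Γ α t₁ t₂} C → Γ ⊢ α ∶ `Type → Γ ⊢ Leibniz α t₁ t₂
                  → (Γ ,∶ α) ⊢ C ∶ `Prop → Γ ⊢ substAt 0 t₁ C → Γ ⊢ substAt 0 t₂ C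
leibniz-transport {t₁ = t₁} {t₂} C α-type t₁=t₂ C-type C[t₁] =
  β-reduce {φ = C} refl
    (⊃E (leibniz-inst {t₁ = t₁} {t₂} t₁=t₂ (lam-type C-type α-type))
        (β-expand {φ = C} refl C[t₁]))

-- Leibniz-equal propositions are equal: transport  x ⊃ x  along  x =_Prop y
-- with the motives  x ⊃ [_]  and  [_] ⊃ x,  then apply propositional
-- extensionality.  Only x needs to be a typed hypothesis.
leibniz⇒≐ : ∀ {Γ x y} → (x ∶ `Prop) ∈ Γ → Γ ⊢ Leibniz `Prop x y → Γ ⊢ x ≐ y
leibniz⇒≐ {Γ} {x} {y} x∈Γ x=y =
  prop-ext (along (⊃-prop (weaken-hyp {α = `Prop} x∈Γ) (ax (here refl))) x⊃[_] x⊃x)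
           (along (⊃-prop (ax (here refl)) (weaken-hyp {α = `Prop} x∈Γ)) [_]⊃x x⊃x)
  where
  x⊃x : Γ ⊢ x ⊃ x
  x⊃x = ⊃I (ax (here refl)) (ax x∈Γ)

  x⊃[_] : ∀ s → substAt 0 s (↑ x ⊃ var 0) ≡ (x ⊃ s)
  x⊃[ s ] = trans (subst-⊃ s (↑ x) (var 0)) (cong (_⊃ s) (subst-shift 0 s x))

  [_]⊃x : ∀ s → substAt 0 s (var 0 ⊃ ↑ x) ≡ (s ⊃ x)
  [ s ]⊃x = trans (subst-⊃ s (var 0) (↑ x)) (cong (s ⊃_) (subst-shift 0 s x))

  -- transport where the motive's instances are given by a meta-level F
  along : ∀ {C} {F : Tm → Tm} → (Γ ,∶ `Prop) ⊢ C ∶ `Prop → (∀ s → substAt 0 s C ≡ F s)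
        → Γ ⊢ F x → Γ ⊢ F y
  along {C} C-type C[_]≡F Fx =
    subst (Γ ⊢_) (C[ y ]≡F)
          (leibniz-transport {t₁ = x} {y} C prop-type x=y C-type
                             (subst (Γ ⊢_) (sym (C[ x ]≡F)) Fx))

lemma4 : [] ⊢ Π `Prop (Π `Prop (Leibniz `Prop (var 1) (var 0) ⊃ (var 1 ≐ var 0)))
lemma4 =
  Π-intro (Π-intro (⊃I (leibniz⇒≐ (there (there (here refl))) (ax (here refl)))
                       (leibniz-type prop-type (there (here refl)) (here refl)))
                   prop-type)
          prop-type
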